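{- For a positive integer $n$, identify the additive group of $\mathbb{F}_{2^n}\times\mathbb{F}_{2^n}$ with $\mathbb{Z}_2^{2n}$ via a group isomorphism, and let $S_{2n}=\{(x,x^3)\mid x\in\mathbb{F}_{2^n}\}$. Then there exist a constant $c>0$ and an integer $n_0$ such that for all $n>n_0$, every element of $\mathbb{Z}_2^{2n}\setminus S_{2n}$ (equivalently, every $(x,y)\in\mathbb{F}_{2^n}^2$ with $y\neq x^3$) is covered at least $c\cdot 2^n$ times by $S_{2n}$; that is, the number of covers is $\Omega(2^n)$.
   Context: A subset $S\subseteq\mathbb{Z}_2^n$ is called Sidon if whenever $a+b=x+y$ with $a,b,x,y\in S$, $a\neq b$, $x\neq y$, we have $\{a,b\}=\{x,y\}$ (i.e. sums of pairs of distinct elements are distinct). The set $S_{2n}$ above is a Sidon set. For a Sidon set $S\subseteq\mathbb{Z}_2^N$, a point $x\in\mathbb{Z}_2^N\setminus S$ is said to be covered $k$ times by $S$ if there are exactly $k$ distinct unordered triples $\{a,b,c\}$ with $a,b,c\in S$ and $a+b+c=x$. -}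

module Defs where

open import Level using (0ℓ)
open import Data.Nat using (ℕ; _^_)
open import Data.Fin using (Fin; _<_; _<?_)
open import Data.Fin.Properties using ()
open import Data.List using (List; length; filter; concatMap; allFin; _∷_; [])
open import Data.Product using (_×_; _,_; Σ; ∃)
open import Relation.Nullary using (Dec; yes; no; ¬_)
open import Relation.Nullary.Decidable using (_×-dec_)
open import Relation.Binary.PropositionalEquality using (_≡_; _≢_)
open import Algebra.Structures using (IsCommutativeRing)
open import Function.Bundles using (_↔_; Inverse)

-- Every such field is F_{2^n}
-- (all finite fields of a given order are isomorphic).
record FiniteField2^ (n : ℕ) : Set₁ where
  infixl 6 _+_
  infixl 7 _*_
  field
    Carrier   : Set
    _+_ _*_   : Carrier → Carrier → Carrier
    -_        : Carrier → Carrier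
    0# 1#     : Carrier
    isCommutativeRing : IsCommutativeRing _≡_ _+_ _*_ -_ 0# 1#
    0≢1       : 0# ≢ 1#
    inverse   : ∀ x → x ≢ 0# → ∃ λ y → x * y ≡ 1#
    _≟_       : (x y : Carrier) → Dec (x ≡ y)
    enum      : Fin (2 ^ n) ↔ Carrier

  cube : Carrier → Carrier
  cube x = x * x * x

  el : Fin (2 ^ n) → Carrier
  el = Inverse.to enum

module _ {n : ℕ} (F : FiniteField2^ n) where
  open FiniteField2^ F

  inS : Carrier × Carrier → Set
  inS (x , y) = y ≡ cube x

  -- all strictly increasing index triples i < j < k, i.e. all
  -- 3-element subsets of F (hence of S_{2n}, via a ↦ (a, a^3))
  orderedTriples : List (Fin (2 ^ n) × Fin (2 ^ n) × Fin (2 ^ n))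
  orderedTriples =
    concatMap (λ i → concatMap (λ j → concatMap (λ k → mk i j k) (allFin _)) (allFin _)) (allFin _)
    where
      mk : Fin (2 ^ n) → Fin (2 ^ n) → Fin (2 ^ n) → List (Fin (2 ^ n) × Fin (2 ^ n) × Fin (2 ^ n))
      mk i j k with i <? j | j <? k
      ... | yes _ | yes _ = (i , j , k) ∷ []
      ... | _ | _ = []

  sumsTo : Carrier × Carrier → Fin (2 ^ n) × Fin (2 ^ n) × Fin (2 ^ n) → Set
  sumsTo (x , y) (i , j , k) =
    (el i + el j + el k ≡ x) × (cube (el i) + cube (el j) + cube (el k) ≡ y)

  sumsTo? : ∀ p t → Dec (sumsTo p t)
  sumsTo? (x , y) (i , j , k) =
    ((el i + el j + el k) ≟ x) ×-dec ((cube (el i) + cube (el j) + cube (el k)) ≟ y)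

  coverCount : Carrier × Carrier → ℕ
  coverCount p = length (filter (sumsTo? p) orderedTriples)

{-# OPTIONS --safe #-}
-- Put D = y + x³, which is nonzero. In characteristic 2,
-- (a + b + c)³ = a³ + b³ + c³ + (a + b)(b + c)(c + a), so for a = u + x, b = v + x
-- and c = u + v + x the points (a, a³), (b, b³), (c, c³) of S sum to (x, y) as soon
-- as u v (u + v) = D, and they are then distinct. Writing u = 1/w and v = u s, this
-- becomes ℘ s = D w³ with ℘ s = s² + s. The map ℘ is additive with kernel {0, 1}, so
-- its image has index 2 in the additive group. If some e has D e³ outside the image,
-- then for each of the (at least half of all) s with D e³ ℘(s) in the image, one of
-- w = e s and w = e s + e has D w³ in the image, because
-- D (e s)³ + D (e s + e)³ = D e³ (℘ s + 1). Hence at least 2ⁿ / 4 elements w qualify;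
-- each w ≠ 0 among them yields a cover, and a cover arises from at most three w.
-- That the field has characteristic 2 at all follows from its even order.
module Submission where

open import Level using (0ℓ)
open import Algebra.Bundles using (CommutativeRing; CommutativeSemigroup)
import Algebra.Properties.CommutativeSemigroup as CommutativeSemigroupProperties
import Algebra.Properties.Group as GroupProperties
import Algebra.Solver.Ring as RingSolver
open import Algebra.Solver.Ring.AlmostCommutativeRing
  using (fromCommutativeRing; _-Raw-AlmostCommutative⟶_; Induced-equivalence)
open import Data.Bool using (Bool; true; false; _xor_; _∧_)
import Data.Bool as Bool
open import Data.Bool.Properties using (xor-∧-commutativeRing)
open import Data.Fin using (Fin; _<?_)
import Data.Fin.Properties as Fin
open import Data.List using (List; []; _∷_; [_]; _++_; length; filter; map; tabulate; allFin; concatMap)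
open import Data.List.Properties
  using (filter-++; length-++; filter-none; filter-all; filter-some; filter-≐; length-tabulate)
open import Data.List.Membership.Propositional using (_∈_; lose)
open import Data.List.Membership.Propositional.Properties
  using (∈-tabulate⁺; ∈-allFin; ∈-concatMap⁺; ∈-map⁺)
import Data.List.Relation.Unary.All as All
open import Data.List.Relation.Unary.All using (All)
import Data.List.Relation.Unary.Any as Any
open import Data.List.Relation.Unary.Any using (here; there)
open import Data.List.Relation.Unary.Any.Properties using (¬Any[])
open import Data.List.Relation.Unary.Unique.Propositional using (Unique; []; _∷_)
open import Data.List.Relation.Unary.Unique.Propositional.Properties using (tabulate⁺)
open import Data.Maybe using (just; nothing)
open import Data.Nat using (ℕ; zero; suc; _^_; _≤_; z≤n; s≤s)
import Data.Nat as Nat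
import Data.Nat.Properties as ℕₚ
open import Data.Nat.Solver using (module +-*-Solver)
open import Data.Product using (Σ; ∃; _×_; _,_; proj₁; proj₂)
open import Data.Product.Properties using (≡-dec)
open import Data.Sum using (_⊎_; inj₁; inj₂)
open import Function using (_∘_; id; _↔_; Inverse)
open import Relation.Binary.Definitions using (DecidableEquality; WeaklyDecidable)
open import Relation.Binary.PropositionalEquality
  using (_≡_; _≢_; refl; sym; trans; cong; cong₂; subst; module ≡-Reasoning)
open import Relation.Nullary using (¬_; Dec; yes; no; contradiction)
open import Relation.Nullary.Decidable using (map′; decidable-stable)
open import Relation.Unary using (Pred; Decidable; ∁; _⊆_; _≐_)
open import Relation.Unary.Properties using (∁?; _∩?_; U?)

open import Defs

-- In characteristic 2 the ring homomorphism from the Boolean ring (xor, ∧) is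
-- well defined, so the ring solver can work with coefficients modulo 2.
module Characteristic2Solver {c ℓ} (R : CommutativeRing c ℓ) where

  open CommutativeRing R
    using (Carrier; _≈_; _+_; _*_; -_; 0#; 1#; +-identityˡ; +-identityʳ; zeroˡ; zeroʳ; *-identityˡ; +-group)
    renaming (sym to ≈-sym; refl to ≈-refl)
  open GroupProperties +-group using (inverseʳ-unique; ε⁻¹≈ε)

  module Solver (1+1≈0 : 1# + 1# ≈ 0#) where

    private
      ⟦_⟧ : Bool → Carrier
      ⟦ false ⟧ = 0#
      ⟦ true  ⟧ = 1#

      ⟦⟧-+ : ∀ a b → ⟦ a xor b ⟧ ≈ ⟦ a ⟧ + ⟦ b ⟧
      ⟦⟧-+ false false = ≈-sym (+-identityˡ 0#)
      ⟦⟧-+ false true  = ≈-sym (+-identityˡ 1#)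
      ⟦⟧-+ true  false = ≈-sym (+-identityʳ 1#)
      ⟦⟧-+ true  true  = ≈-sym 1+1≈0

      ⟦⟧-* : ∀ a b → ⟦ a ∧ b ⟧ ≈ ⟦ a ⟧ * ⟦ b ⟧
      ⟦⟧-* false b     = ≈-sym (zeroˡ ⟦ b ⟧)
      ⟦⟧-* true  false = ≈-sym (zeroʳ 1#)
      ⟦⟧-* true  true  = ≈-sym (*-identityˡ 1#)

      ⟦⟧-- : ∀ a → ⟦ a ⟧ ≈ - ⟦ a ⟧
      ⟦⟧-- false = ≈-sym ε⁻¹≈ε
      ⟦⟧-- true  = inverseʳ-unique 1# 1# 1+1≈0

      mod2 : CommutativeRing.rawRing xor-∧-commutativeRing
               -Raw-AlmostCommutative⟶ fromCommutativeRing R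
      mod2 = record
        { ⟦_⟧ = ⟦_⟧ ; +-homo = ⟦⟧-+ ; *-homo = ⟦⟧-* ; -‿homo = ⟦⟧--
        ; 0-homo = ≈-refl ; 1-homo = ≈-refl
        }

      _≟₂_ : WeaklyDecidable (Induced-equivalence mod2)
      a ≟₂ b with a Bool.≟ b
      ... | yes refl = just ≈-refl
      ... | no  _      = nothing

    open RingSolver (CommutativeRing.rawRing xor-∧-commutativeRing)
      (fromCommutativeRing R) mod2 _≟₂_ public
      using (solve; _:=_; _:+_; _:*_; con)

module _ {A : Set} where

  open Nat using (_+_; _*_)

  count : {P : Pred A 0ℓ} → Decidable P → List A → ℕ
  count P? xs = length (filter P? xs)

  module _ {P : Pred A 0ℓ} (P? : Decidable P) where

    count-++ : ∀ xs ys → count P? (xs ++ ys) ≡ count P? xs + count P? ys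
    count-++ xs ys = trans (cong length (filter-++ P? xs ys)) (length-++ (filter P? xs))

    count-none : ∀ xs → All (∁ P) xs → count P? xs ≡ 0
    count-none _ ¬Pxs = cong length (filter-none P? ¬Pxs)

    count-all : ∀ xs → All P xs → count P? xs ≡ length xs
    count-all _ Pxs = cong length (filter-all P? Pxs)

    count-complement : ∀ xs → count P? xs + count (∁? P?) xs ≡ length xs
    count-complement []       = refl
    count-complement (x ∷ xs) with P? x
    ... | yes _ = cong suc (count-complement xs)
    ... | no  _ = trans (ℕₚ.+-suc _ _) (cong suc (count-complement xs))

    module _ {Q : Pred A 0ℓ} (Q? : Decidable Q) where

      count-split : ∀ xs → count P? xs ≡ count (P? ∩? Q?) xs + count (P? ∩? ∁? Q?) xs
      count-split []       = refl
      count-split (x ∷ xs) with P? x | Q? x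
      ... | yes _ | yes _ = cong suc (count-split xs)
      ... | yes _ | no  _ = trans (cong suc (count-split xs)) (sym (ℕₚ.+-suc _ _))
      ... | no  _ | _     = count-split xs

      count-mono : P ⊆ Q → ∀ xs → count P? xs ≤ count Q? xs
      count-mono P⊆Q []       = z≤n
      count-mono P⊆Q (x ∷ xs) with P? x | Q? x
      ... | yes _  | yes _  = s≤s (count-mono P⊆Q xs)
      ... | yes Px | no ¬Qx = contradiction (P⊆Q Px) ¬Qx
      ... | no  _  | yes _  = ℕₚ.m≤n⇒m≤1+n (count-mono P⊆Q xs)
      ... | no  _  | no  _  = count-mono P⊆Q xs

      count-cong : P ≐ Q → ∀ xs → count P? xs ≡ count Q? xs
      count-cong P≐Q xs = cong length (filter-≐ P? Q? P≐Q xs)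

  unique⇒count-≟≤1 : (_≟_ : DecidableEquality A) → ∀ {xs} → Unique xs → ∀ a → count (_≟ a) xs ≤ 1
  unique⇒count-≟≤1 _≟_ [] a = z≤n
  unique⇒count-≟≤1 _≟_ {x ∷ xs} (x∉xs ∷ xs-unique) a with x ≟ a
  ... | yes refl = s≤s (ℕₚ.≤-reflexive (count-none (_≟ x) xs (All.map (λ x≢y y≡x → x≢y (sym y≡x)) x∉xs)))
  ... | no  _    = unique⇒count-≟≤1 _≟_ xs-unique a

module _ {A B : Set} (_≟_ : DecidableEquality B) (f : A → B) where

  open Nat using (_+_; _*_)

  fibre? : {P : Pred A 0ℓ} → Decidable P → (b : B) → Decidable (λ a → P a × f a ≡ b)
  fibre? P? b = P? ∩? (λ a → f a ≟ b)

  count-≤-fibres : ∀ {P : Pred A 0ℓ} {Q : Pred B 0ℓ} (P? : Decidable P) (Q? : Decidable Q) k xs ys →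
                   (∀ {a} → P a → f a ∈ ys × Q (f a)) →
                   (∀ b → count (fibre? P? b) xs ≤ k) →
                   count P? xs ≤ k * count Q? ys
  count-≤-fibres P? Q? k xs [] maps fibres =
    ℕₚ.≤-trans (ℕₚ.≤-reflexive (count-none P? xs (All.tabulate λ _ Pa → ¬Any[] (proj₁ (maps Pa))))) z≤n
  count-≤-fibres {P} {Q} P? Q? k xs (y ∷ ys) maps fibres = begin
    count P? xs                                       ≡⟨ count-split P? (λ a → f a ≟ y) xs ⟩
    count (fibre? P? y) xs + count P′? xs             ≤⟨ ℕₚ.+-mono-≤ head rest ⟩
    k * count Q? [ y ] + k * count Q? ys              ≡⟨ sym (ℕₚ.*-distribˡ-+ k _ _) ⟩
    k * (count Q? [ y ] + count Q? ys)                ≡⟨ cong (k *_) (sym (count-++ Q? [ y ] ys)) ⟩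
    k * count Q? (y ∷ ys)                             ∎
    where
    open ℕₚ.≤-Reasoning
    P′? : Decidable (λ a → P a × f a ≢ y)
    P′? = P? ∩? ∁? (λ a → f a ≟ y)

    head : count (fibre? P? y) xs ≤ k * count Q? [ y ]
    head with Q? y
    ... | yes _  = ℕₚ.≤-trans (fibres y) (ℕₚ.≤-reflexive (sym (ℕₚ.*-identityʳ k)))
    ... | no ¬Qy = ℕₚ.≤-trans
      (ℕₚ.≤-reflexive (count-none (fibre? P? y) xs
        (All.tabulate λ {a} _ (Pa , fa≡y) → ¬Qy (subst Q fa≡y (proj₂ (maps Pa))))))
      z≤n

    rest : count P′? xs ≤ k * count Q? ys
    rest = count-≤-fibres P′? Q? k xs ys maps′ fibres′
      where
      maps′ : ∀ {a} → P a × f a ≢ y → f a ∈ ys × Q (f a)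
      maps′ (Pa , fa≢y) with maps Pa
      ... | here fa≡y , _ = contradiction fa≡y fa≢y
      ... | there fa∈ys , Qfa = fa∈ys , Qfa

      fibres′ : ∀ b → count (fibre? P′? b) xs ≤ k
      fibres′ b = ℕₚ.≤-trans (count-mono (fibre? P′? b) (fibre? P? b) (λ ((Pa , _) , fa≡b) → Pa , fa≡b) xs)
                            (fibres b)


module Enumeration {A : Set} {N : ℕ} (_≟_ : DecidableEquality A) (enum : Fin N ↔ A) where

  open Nat using (_+_; _*_)
  open import Data.Fin using (_<_)
  open Inverse enum using (to; from; strictlyInverseˡ; strictlyInverseʳ)

  to-injective : ∀ {i j} → to i ≡ to j → i ≡ j
  to-injective {i} {j} eq = trans (sym (strictlyInverseʳ i)) (trans (cong from eq) (strictlyInverseʳ j))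

  from-injective : ∀ {a b} → from a ≡ from b → a ≡ b
  from-injective {a} {b} eq = trans (sym (strictlyInverseˡ a)) (trans (cong to eq) (strictlyInverseˡ b))

  elements : List A
  elements = tabulate to

  ∈-elements : ∀ a → a ∈ elements
  ∈-elements a = subst (_∈ elements) (strictlyInverseˡ a) (∈-tabulate⁺ (from a))

  ∃? : {P : Pred A 0ℓ} → Decidable P → Dec (∃ P)
  ∃? {P} P? = map′ (λ (i , Pi) → to i , Pi)
                   (λ (a , Pa) → from a , subst P (sym (strictlyInverseˡ a)) Pa)
                   (Fin.any? (P? ∘ to))

  ∣_∣ : {P : Pred A 0ℓ} → Decidable P → ℕ
  ∣ P? ∣ = count P? elements

  module _ {P : Pred A 0ℓ} (P? : Decidable P) where

    ∣∣-complement : ∣ P? ∣ + ∣ ∁? P? ∣ ≡ N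
    ∣∣-complement = trans (count-complement P? elements) (length-tabulate to)

    ∣∣-universal : (∀ a → P a) → ∣ P? ∣ ≡ N
    ∣∣-universal Pall = trans (count-all P? elements (All.tabulate λ {a} _ → Pall a)) (length-tabulate to)

    ∣∣-≤-fibres : ∀ {Q : Pred A 0ℓ} (Q? : Decidable Q) (f : A → A) k →
           (∀ {a} → P a → Q (f a)) → (∀ b → ∣ fibre? _≟_ f P? b ∣ ≤ k) →
           ∣ P? ∣ ≤ k * ∣ Q? ∣
    ∣∣-≤-fibres Q? f k maps = count-≤-fibres _≟_ f P? Q? k elements elements (λ Pa → ∈-elements _ , maps Pa)

  ∣≟∣≡1 : ∀ a → ∣ _≟ a ∣ ≡ 1
  ∣≟∣≡1 a = ℕₚ.≤-antisym (unique⇒count-≟≤1 _≟_ (tabulate⁺ to-injective) a)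
                       (filter-some (_≟ a) (Any.map sym (∈-elements a)))

  ∣∣-≤-length : ∀ {P : Pred A 0ℓ} (P? : Decidable P) {cs} →
                (∀ {a} → P a → a ∈ cs) → ∣ P? ∣ ≤ length cs
  ∣∣-≤-length P? {cs} P⊆cs = begin
    ∣ P? ∣                 ≤⟨ count-≤-fibres _≟_ id P? U? 1 elements cs (λ Pa → P⊆cs Pa , _) single ⟩
    1 * count U? cs        ≡⟨ ℕₚ.*-identityˡ _ ⟩
    count U? cs            ≡⟨ count-all U? cs (All.tabulate _) ⟩
    length cs              ∎
    where
    open ℕₚ.≤-Reasoning
    single : ∀ b → ∣ fibre? _≟_ id P? b ∣ ≤ 1
    single b = ℕₚ.≤-trans (count-mono (fibre? _≟_ id P? b) (_≟ b) proj₂ elements)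
                          (ℕₚ.≤-reflexive (∣≟∣≡1 b))

  ∣∣-≤-injection : ∀ {P Q : Pred A 0ℓ} (P? : Decidable P) (Q? : Decidable Q) (f g : A → A) →
                   (∀ {a} → P a → Q (f a)) → (∀ a → g (f a) ≡ a) → ∣ P? ∣ ≤ ∣ Q? ∣
  ∣∣-≤-injection P? Q? f g maps g∘f≗id =
    ℕₚ.≤-trans (∣∣-≤-fibres P? Q? f 1 maps single) (ℕₚ.≤-reflexive (ℕₚ.*-identityˡ _))
    where
    single : ∀ b → ∣ fibre? _≟_ f P? b ∣ ≤ 1
    single b = ∣∣-≤-length (fibre? _≟_ f P? b) {g b ∷ []}
                 λ {a} (_ , fa≡b) → here (trans (sym (g∘f≗id a)) (cong g fa≡b))

  -- Points off the diagonal of σ pair up as {a, σ a}; `from` picks a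
  -- representative of each pair.
  involution-parity : (σ : A → A) → (∀ a → σ (σ a) ≡ a) →
                      ∃ λ m → N ≡ ∣ (λ a → σ a ≟ a) ∣ + 2 * m
  involution-parity σ σ-involutive = ∣ rises? ∣ , (begin
    N                                                  ≡⟨ sym (∣∣-complement rises?) ⟩
    ∣ rises? ∣ + ∣ ∁? rises? ∣
      ≡⟨ cong (∣ rises? ∣ +_) (count-split (∁? rises?) falls? elements) ⟩
    ∣ rises? ∣ + (∣ ∁? rises? ∩? falls? ∣ + ∣ ∁? rises? ∩? ∁? falls? ∣)
      ≡⟨ cong₂ (λ p q → ∣ rises? ∣ + (p + q)) (count-cong _ _ falls≐ elements) (count-cong _ _ fixed≐ elements) ⟩
    ∣ rises? ∣ + (∣ falls? ∣ + ∣ fixed? ∣)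
      ≡⟨ cong (λ p → ∣ rises? ∣ + (p + ∣ fixed? ∣)) (sym ∣rises∣≡∣falls∣) ⟩
    ∣ rises? ∣ + (∣ rises? ∣ + ∣ fixed? ∣)               ≡⟨ arrange ∣ rises? ∣ ∣ fixed? ∣ ⟩
    ∣ fixed? ∣ + 2 * ∣ rises? ∣                         ∎)
    where
    open ≡-Reasoning
    rises? : Decidable (λ a → from a < from (σ a))
    rises? a = from a <? from (σ a)

    falls? : Decidable (λ a → from (σ a) < from a)
    falls? a = from (σ a) <? from a

    fixed? : Decidable (λ a → σ a ≡ a)
    fixed? a = σ a ≟ a

    falls≐ : (λ a → ¬ (from a < from (σ a)) × from (σ a) < from a) ≐ (λ a → from (σ a) < from a)
    falls≐ = proj₂ , λ σa<a → Fin.<-asym σa<a , σa<a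

    fixed≐ : (λ a → ¬ (from a < from (σ a)) × ¬ (from (σ a) < from a)) ≐ (λ a → σ a ≡ a)
    fixed≐ = (λ (a≮σa , σa≮a) → sym (from-injective (Fin.≤-antisym (ℕₚ.≮⇒≥ σa≮a) (ℕₚ.≮⇒≥ a≮σa))))
           , λ σa≡a → Fin.<-irrefl (cong from (sym σa≡a)) , Fin.<-irrefl (cong from σa≡a)

    ∣rises∣≡∣falls∣ : ∣ rises? ∣ ≡ ∣ falls? ∣
    ∣rises∣≡∣falls∣ = ℕₚ.≤-antisym
      (∣∣-≤-injection rises? falls? σ σ
        (λ {a} a<σa → subst (λ b → from b < from (σ a)) (sym (σ-involutive a)) a<σa) σ-involutive)
      (∣∣-≤-injection falls? rises? σ σ
        (λ {a} σa<a → subst (λ b → from (σ a) < from b) (sym (σ-involutive a)) σa<a) σ-involutive)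

    arrange : ∀ r f → r + (r + f) ≡ f + 2 * r
    arrange = solve 2 (λ r f → r :+ (r :+ f) := f :+ con 2 :* r) refl
      where open +-*-Solver

Triple : ℕ → Set
Triple m = Fin m × Fin m × Fin m

module _ {m : ℕ} where

  open import Data.Fin using (_<_)

  entries : Triple m → List (Fin m)
  entries (i , j , k) = i ∷ j ∷ k ∷ []

  Increasing : Triple m → Set
  Increasing (i , j , k) = i < j × j < k

  insert : Fin m → Fin m → Fin m → Triple m
  insert c p q with c <? p | c <? q
  ... | yes _ | _     = c , p , q
  ... | no  _ | yes _ = p , c , q
  ... | no  _ | no  _ = p , q , c

  sort₃ : Fin m → Fin m → Fin m → Triple m
  sort₃ a b c with a <? b
  ... | yes _ = insert c a b
  ... | no  _ = insert c b a

  private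
    ≮∧≢⇒> : ∀ {i j : Fin m} → ¬ i < j → i ≢ j → j < i
    ≮∧≢⇒> i≮j i≢j = Fin.≤∧≢⇒< (ℕₚ.≮⇒≥ i≮j) (i≢j ∘ sym)

  insert-increasing : ∀ {c p q} → p < q → c ≢ p → c ≢ q → Increasing (insert c p q)
  insert-increasing {c} {p} {q} p<q c≢p c≢q with c <? p | c <? q
  ... | yes c<p | _       = c<p , p<q
  ... | no  c≮p | yes c<q = ≮∧≢⇒> c≮p c≢p , c<q
  ... | no  _   | no  c≮q = p<q , ≮∧≢⇒> c≮q c≢q

  sort₃-increasing : ∀ {a b c} → a ≢ b → b ≢ c → a ≢ c → Increasing (sort₃ a b c)
  sort₃-increasing {a} {b} {c} a≢b b≢c a≢c with a <? b
  ... | yes a<b = insert-increasing a<b (a≢c ∘ sym) (b≢c ∘ sym)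
  ... | no  a≮b = insert-increasing (≮∧≢⇒> a≮b a≢b) (b≢c ∘ sym) (a≢c ∘ sym)

  ∈-insert : ∀ c p q → p ∈ entries (insert c p q) × q ∈ entries (insert c p q)
  ∈-insert c p q with c <? p | c <? q
  ... | yes _ | _     = there (here refl) , there (there (here refl))
  ... | no  _ | yes _ = here refl , there (there (here refl))
  ... | no  _ | no  _ = here refl , there (here refl)

  ∈-sort₃ : ∀ a b c → a ∈ entries (sort₃ a b c)
  ∈-sort₃ a b c with a <? b
  ... | yes _ = proj₁ (∈-insert c a b)
  ... | no  _ = proj₂ (∈-insert c b a)

  module _ {ℓ₁ ℓ₂} (M : CommutativeSemigroup ℓ₁ ℓ₂) where

    open CommutativeSemigroup M using (Carrier; _≈_; _∙_; ∙-congʳ; comm) renaming (refl to ≈-refl; trans to ≈-trans)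
    open CommutativeSemigroupProperties M using (xy∙z≈yz∙x; xy∙z≈xz∙y)

    fold₃ : (Fin m → Carrier) → Triple m → Carrier
    fold₃ g (i , j , k) = g i ∙ g j ∙ g k

    insert-fold : ∀ g c p q → fold₃ g (insert c p q) ≈ g p ∙ g q ∙ g c
    insert-fold g c p q with c <? p | c <? q
    ... | yes _ | _     = xy∙z≈yz∙x (g c) (g p) (g q)
    ... | no  _ | yes _ = xy∙z≈xz∙y (g p) (g c) (g q)
    ... | no  _ | no  _ = ≈-refl

    sort₃-fold : ∀ g a b c → fold₃ g (sort₃ a b c) ≈ g a ∙ g b ∙ g c
    sort₃-fold g a b c with a <? b
    ... | yes _ = insert-fold g c a b
    ... | no  _ = ≈-trans (insert-fold g c b a) (∙-congʳ (comm (g b) (g a)))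

module FiniteFieldProperties {n : ℕ} (F : FiniteField2^ n) where

  open FiniteField2^ F
  open Enumeration _≟_ enum public

  ring : CommutativeRing 0ℓ 0ℓ
  ring = record { isCommutativeRing = isCommutativeRing }

  open CommutativeRing ring
    using ( *-assoc; *-comm; *-identityˡ; *-identityʳ; zeroˡ; zeroʳ; distribʳ; -‿inverseʳ
          ; +-identityˡ; +-comm; +-group; +-commutativeSemigroup)
  open GroupProperties +-group using (⁻¹-involutive; ε⁻¹≈ε)

  x*y≡0⇒x≡0⊎y≡0 : ∀ {a b} → a * b ≡ 0# → a ≡ 0# ⊎ b ≡ 0#
  x*y≡0⇒x≡0⊎y≡0 {a} {b} ab≡0 with a ≟ 0#
  ... | yes a≡0 = inj₁ a≡0
  ... | no  a≢0 with inverse a a≢0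
  ... | a⁻¹ , aa⁻¹≡1 = inj₂ (begin
    b               ≡⟨ sym (*-identityˡ b) ⟩
    1# * b          ≡⟨ cong (_* b) (trans (sym aa⁻¹≡1) (*-comm a a⁻¹)) ⟩
    a⁻¹ * a * b     ≡⟨ *-assoc a⁻¹ a b ⟩
    a⁻¹ * (a * b)   ≡⟨ cong (a⁻¹ *_) ab≡0 ⟩
    a⁻¹ * 0#        ≡⟨ zeroʳ a⁻¹ ⟩
    0#              ∎)
    where open ≡-Reasoning

  inv : Carrier → Carrier
  inv a with a ≟ 0#
  ... | yes _   = 0#
  ... | no  a≢0 = proj₁ (inverse a a≢0)

  x*inv-x≡1 : ∀ {a} → a ≢ 0# → a * inv a ≡ 1#
  x*inv-x≡1 {a} a≢0 with a ≟ 0#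
  ... | yes a≡0 = contradiction a≡0 a≢0
  ... | no  a≢0 = proj₂ (inverse a a≢0)

  inv-unique : ∀ {a b} → a * b ≡ 1# → b ≡ inv a
  inv-unique {a} {b} ab≡1 = begin
    b                 ≡⟨ sym (*-identityʳ b) ⟩
    b * 1#            ≡⟨ cong (b *_) (sym (x*inv-x≡1 a≢0)) ⟩
    b * (a * inv a)   ≡⟨ sym (*-assoc b a (inv a)) ⟩
    b * a * inv a     ≡⟨ cong (_* inv a) (trans (*-comm b a) ab≡1) ⟩
    1# * inv a        ≡⟨ *-identityˡ (inv a) ⟩
    inv a             ∎
    where
    open ≡-Reasoning
    a≢0 : a ≢ 0#
    a≢0 a≡0 = 0≢1 (trans (sym (zeroˡ b)) (trans (cong (_* b) (sym a≡0)) ab≡1))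

  inv-involutive : ∀ {a} → a ≢ 0# → inv (inv a) ≡ a
  inv-involutive a≢0 = sym (inv-unique (trans (*-comm _ _) (x*inv-x≡1 a≢0)))

  inv-cancel : ∀ {a b c} → a ≢ 0# → a * b ≡ c → b ≡ inv a * c
  inv-cancel {a} {b} {c} a≢0 ab≡c = begin
    b                 ≡⟨ sym (*-identityˡ b) ⟩
    1# * b            ≡⟨ cong (_* b) (trans (sym (x*inv-x≡1 a≢0)) (*-comm a (inv a))) ⟩
    inv a * a * b     ≡⟨ *-assoc (inv a) a b ⟩
    inv a * (a * b)   ≡⟨ cong (inv a *_) ab≡c ⟩
    inv a * c         ∎
    where open ≡-Reasoning

  -x≡x⇒x≡0 : 1# + 1# ≢ 0# → ∀ {a} → - a ≡ a → a ≡ 0#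
  -x≡x⇒x≡0 2≢0 {a} -a≡a with x*y≡0⇒x≡0⊎y≡0 (begin
    (1# + 1#) * a     ≡⟨ distribʳ a 1# 1# ⟩
    1# * a + 1# * a   ≡⟨ cong₂ _+_ (*-identityˡ a) (trans (*-identityˡ a) (sym -a≡a)) ⟩
    a + - a           ≡⟨ -‿inverseʳ a ⟩
    0#                ∎)
    where open ≡-Reasoning
  ... | inj₁ 2≡0 = contradiction 2≡0 2≢0
  ... | inj₂ a≡0 = a≡0

  private
    power-of-two-even : ∀ {k} → 1 ≤ k → ∃ λ h → 2 ^ k ≡ 2 Nat.* h
    power-of-two-even {suc k} _ = 2 ^ k , refl

  -- Unless 1 + 1 = 0, the nonzero elements pair up as {a, - a}, which would
  -- make the order 2 ^ n odd.
  characteristic-two : 1 ≤ n → 1# + 1# ≡ 0#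
  characteristic-two 1≤n with (1# + 1#) ≟ 0#
  ... | yes 2≡0 = 2≡0
  ... | no  2≢0 with involution-parity -_ ⁻¹-involutive | power-of-two-even 1≤n
  ... | m , 2^n≡fixed+2m | h , 2^n≡2h = contradiction (begin
    2 Nat.* h                               ≡⟨ sym 2^n≡2h ⟩
    2 ^ n                                   ≡⟨ 2^n≡fixed+2m ⟩
    ∣ (λ a → (- a) ≟ a) ∣ Nat.+ 2 Nat.* m   ≡⟨ cong (Nat._+ 2 Nat.* m) ∣fixed∣≡1 ⟩
    suc (2 Nat.* m)                         ∎) (ℕₚ.even≢odd h m)
    where
    open ≡-Reasoning
    fixed≐0 : (λ a → - a ≡ a) ≐ (_≡ 0#)
    fixed≐0 = -x≡x⇒x≡0 2≢0 , λ { refl → ε⁻¹≈ε }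

    ∣fixed∣≡1 : ∣ (λ a → (- a) ≟ a) ∣ ≡ 1
    ∣fixed∣≡1 = trans (count-cong _ (_≟ 0#) fixed≐0 elements) (∣≟∣≡1 0#)

  increasing∈orderedTriples : ∀ {t : Triple (2 ^ n)} → Increasing t → t ∈ orderedTriples F
  increasing∈orderedTriples {i , j , k} (i<j , j<k) =
    ∈-concatMap⁺ _ (lose (∈-allFin i) (∈-concatMap⁺ _ (lose (∈-allFin j)
      (∈-concatMap⁺ _ (lose (∈-allFin k) keep)))))
    where
    -- The test inside `orderedTriples` is local to its definition; unification recovers it.
    shape : Σ (Fin (2 ^ n) → Fin (2 ^ n) → Fin (2 ^ n) → List (Triple (2 ^ n))) λ G →
            orderedTriples F ≡ concatMap (λ i → concatMap (λ j → concatMap (G i j) (allFin _)) (allFin _)) (allFin _)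
    shape = _ , refl

    keep : (i , j , k) ∈ proj₁ shape i j k
    keep with i <? j | j <? k
    ... | yes _  | yes _  = here refl
    ... | no i≮j | _      = contradiction i<j i≮j
    ... | yes _  | no j≮k = contradiction j<k j≮k

  module Characteristic2 (1+1≡0 : 1# + 1# ≡ 0#) where

    open Characteristic2Solver.Solver ring 1+1≡0

    x+x≡0 : ∀ a → a + a ≡ 0#
    x+x≡0 = solve 1 (λ a → a :+ a := con false) refl

    x+y≡z⇒x≡z+y : ∀ {a b c} → a + b ≡ c → a ≡ c + b
    x+y≡z⇒x≡z+y {a} {b} a+b≡c = trans (solve 2 (λ a b → a := a :+ b :+ b) refl a b) (cong (_+ b) a+b≡c)

    ℘ : Carrier → Carrier
    ℘ s = s * s + s

    ℘-+ : ∀ s t → ℘ (s + t) ≡ ℘ s + ℘ t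
    ℘-+ = solve 2 (λ s t → (s :+ t) :* (s :+ t) :+ (s :+ t) := s :* s :+ s :+ (t :* t :+ t)) refl

    ℘≡0 : ∀ {s} → ℘ s ≡ 0# → s ≡ 0# ⊎ s ≡ 1#
    ℘≡0 {s} ℘s≡0
      with x*y≡0⇒x≡0⊎y≡0 (trans (solve 1 (λ s → s :* (s :+ con true) := s :* s :+ s) refl s) ℘s≡0)
    ... | inj₁ s≡0   = inj₁ s≡0
    ... | inj₂ s+1≡0 = inj₂ (trans (x+y≡z⇒x≡z+y s+1≡0) (+-identityˡ 1#))

    ℘-image : Pred Carrier 0ℓ
    ℘-image z = ∃ λ s → ℘ s ≡ z

    ℘-image? : Decidable ℘-image
    ℘-image? z = ∃? (λ s → ℘ s ≟ z)

    ℘-image-+ : ∀ {a b} → ℘-image a → ℘-image b → ℘-image (a + b)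
    ℘-image-+ (s , ℘s≡a) (t , ℘t≡b) = s + t , trans (℘-+ s t) (cong₂ _+_ ℘s≡a ℘t≡b)

    ℘-root : Carrier → Carrier
    ℘-root z with ℘-image? z
    ... | yes (s , _) = s
    ... | no  _       = 0#

    ℘-℘-root : ∀ {z} → ℘-image z → ℘ (℘-root z) ≡ z
    ℘-℘-root {z} z∈℘ with ℘-image? z
    ... | yes (_ , ℘s≡z) = ℘s≡z
    ... | no  z∉℘        = contradiction z∈℘ z∉℘

    ∣℘-image∣≥half : 2 ^ n ≤ 2 Nat.* ∣ ℘-image? ∣
    ∣℘-image∣≥half = begin
      2 ^ n                 ≡⟨ sym (∣∣-universal U? _) ⟩
      ∣ U? ∣                ≤⟨ ∣∣-≤-fibres U? ℘-image? ℘ 2 (λ {s} _ → s , refl) fibres ⟩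
      2 Nat.* ∣ ℘-image? ∣  ∎
      where
      open ℕₚ.≤-Reasoning

      roots : ∀ {s z} → ℘ s ≡ z → s ∈ ℘-root z ∷ ℘-root z + 1# ∷ []
      roots {s} {z} ℘s≡z
        with ℘≡0 (trans (℘-+ s (℘-root z)) (trans (cong₂ _+_ ℘s≡z (℘-℘-root (s , ℘s≡z))) (x+x≡0 z)))
      ... | inj₁ s+r≡0 = here (trans (x+y≡z⇒x≡z+y s+r≡0) (+-identityˡ _))
      ... | inj₂ s+r≡1 = there (here (trans (x+y≡z⇒x≡z+y s+r≡1) (+-comm 1# _)))

      fibres : ∀ z → ∣ fibre? _≟_ ℘ U? z ∣ ≤ 2
      fibres z = ∣∣-≤-length (fibre? _≟_ ℘ U? z) (roots ∘ proj₂)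

    -- For an additive subgroup P this says that P has index at most 2.
    IndexTwo : Pred Carrier 0ℓ → Set
    IndexTwo P = ∀ {a b} → ¬ P a → ¬ P b → P (a + b)

    module _ {P : Pred Carrier 0ℓ} (P? : Decidable P) where

      private
        m+m≡2*m : ∀ m → m Nat.+ m ≡ 2 Nat.* m
        m+m≡2*m m = cong (m Nat.+_) (sym (ℕₚ.+-identityʳ m))

      indexTwo⇒half : IndexTwo P → 2 ^ n ≤ 2 Nat.* ∣ P? ∣
      indexTwo⇒half sum∈P with ∃? (∁? P?)
      ... | no ∄¬P = begin
        2 ^ n               ≡⟨ sym (∣∣-universal P? λ a → decidable-stable (P? a) λ ¬Pa → ∄¬P (a , ¬Pa)) ⟩
        ∣ P? ∣              ≤⟨ ℕₚ.m≤n*m _ 2 ⟩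
        2 Nat.* ∣ P? ∣      ∎
        where open ℕₚ.≤-Reasoning
      ... | yes (c , ¬Pc) = begin
        2 ^ n                     ≡⟨ sym (∣∣-complement P?) ⟩
        ∣ P? ∣ Nat.+ ∣ ∁? P? ∣    ≤⟨ ℕₚ.+-monoʳ-≤ ∣ P? ∣ (∣∣-≤-injection (∁? P?) P? (_+ c) (_+ c)
                                       (λ ¬Pa → sum∈P ¬Pa ¬Pc)
                                       (λ a → solve 2 (λ a c → a :+ c :+ c := a) refl a c)) ⟩
        ∣ P? ∣ Nat.+ ∣ P? ∣       ≡⟨ m+m≡2*m ∣ P? ∣ ⟩
        2 Nat.* ∣ P? ∣            ∎
        where open ℕₚ.≤-Reasoning

      half⇒indexTwo : (∀ {a b} → P a → P b → P (a + b)) → 2 ^ n ≤ 2 Nat.* ∣ P? ∣ → IndexTwo P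
      half⇒indexTwo closed half {a} {b} ¬Pa ¬Pb =
        decidable-stable (P? (a + b)) λ ¬P[a+b] → ℕₚ.<⇒≱ (too-few ¬P[a+b]) half
        where
        -- z ↦ z + a embeds P into the complement of P, missing b.
        too-few : ¬ P (a + b) → 2 Nat.* ∣ P? ∣ Nat.< 2 ^ n
        too-few ¬P[a+b] = begin-strict
          2 Nat.* ∣ P? ∣                                       ≡⟨ sym (m+m≡2*m ∣ P? ∣) ⟩
          ∣ P? ∣ Nat.+ ∣ P? ∣                                  <⟨ ℕₚ.+-monoʳ-< ∣ P? ∣ P<∁P ⟩
          ∣ P? ∣ Nat.+ ∣ ∁? P? ∣                               ≡⟨ ∣∣-complement P? ⟩
          2 ^ n                                                ∎
          where
          open ℕₚ.≤-Reasoning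
          ∁P∖b? : Decidable (λ z → ¬ P z × z ≢ b)
          ∁P∖b? = ∁? P? ∩? ∁? (_≟ b)

          translate : ∀ {z} → P z → ¬ P (z + a) × z + a ≢ b
          translate {z} Pz =
              (λ P[z+a] → ¬Pa (subst P (solve 2 (λ z a → z :+ (z :+ a) := a) refl z a) (closed Pz P[z+a])))
            , (λ z+a≡b → ¬P[a+b] (subst P (trans (x+y≡z⇒x≡z+y z+a≡b) (+-comm b a)) Pz))

          P<∁P : ∣ P? ∣ Nat.< ∣ ∁? P? ∣
          P<∁P = begin-strict
            ∣ P? ∣                                ≤⟨ ∣∣-≤-injection P? ∁P∖b? (_+ a) (_+ a) translate
                                                         (λ z → solve 2 (λ z a → z :+ a :+ a := z) refl z a) ⟩
            ∣ ∁P∖b? ∣                             <⟨ ℕₚ.n<1+n _ ⟩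
            1 Nat.+ ∣ ∁P∖b? ∣                     ≡⟨ cong (Nat._+ ∣ ∁P∖b? ∣) ∣b∣≡1 ⟨
            ∣ ∁? P? ∩? (_≟ b) ∣ Nat.+ ∣ ∁P∖b? ∣   ≡⟨ count-split (∁? P?) (_≟ b) elements ⟨
            ∣ ∁? P? ∣                             ∎
            where
            b-only : (λ z → ¬ P z × z ≡ b) ≐ (_≡ b)
            b-only = proj₂ , λ { refl → ¬Pb , refl }

            ∣b∣≡1 : ∣ ∁? P? ∩? (_≟ b) ∣ ≡ 1
            ∣b∣≡1 = trans (count-cong _ _ b-only elements) (∣≟∣≡1 b)

    ℘-image-indexTwo : IndexTwo ℘-image
    ℘-image-indexTwo = half⇒indexTwo ℘-image? ℘-image-+ ∣℘-image∣≥half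

    module CubeTwist (D : Carrier) where

      Twisted : Pred Carrier 0ℓ
      Twisted w = ℘-image (D * cube w)

      twisted? : Decidable Twisted
      twisted? w = ℘-image? (D * cube w)

      0-twisted : Twisted 0#
      0-twisted = 0# , solve 1 (λ D → con false :* con false :+ con false
                                    := D :* (con false :* con false :* con false)) refl D

      module _ {e : Carrier} (¬Te : ¬ Twisted e) where

        Scaled : Pred Carrier 0ℓ
        Scaled s = ℘-image (D * cube e * ℘ s)

        scaled? : Decidable Scaled
        scaled? s = ℘-image? (D * cube e * ℘ s)

        scaled-indexTwo : IndexTwo Scaled
        scaled-indexTwo {s} {t} ¬Ss ¬St = subst ℘-image
          (solve 4 (λ D e s t → D :* (e :* e :* e) :* (s :* s :+ s) :+ D :* (e :* e :* e) :* (t :* t :+ t)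
                            := D :* (e :* e :* e) :* ((s :+ t) :* (s :+ t) :+ (s :+ t))) refl D e s t)
          (℘-image-indexTwo ¬Ss ¬St)

        pick : Carrier → Carrier
        pick s with twisted? (e * s)
        ... | yes _ = e * s
        ... | no  _ = e * s + e

        -- D (e s)³ + D (e s + e)³ + D e³ ℘ s = D e³ is not in the image of ℘.
        pick-twisted : ∀ {s} → Scaled s → Twisted (pick s)
        pick-twisted {s} Ss with twisted? (e * s)
        ... | yes Tes = Tes
        ... | no ¬Tes = decidable-stable (twisted? (e * s + e)) λ ¬T[es+e] →
          ¬Te (subst ℘-image
            (solve 3 (λ D e s → D :* (e :* s :* (e :* s) :* (e :* s))
                                :+ D :* ((e :* s :+ e) :* (e :* s :+ e) :* (e :* s :+ e))
                                :+ D :* (e :* e :* e) :* (s :* s :+ s)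
                                := D :* (e :* e :* e)) refl D e s)
            (℘-image-+ (℘-image-indexTwo ¬Tes ¬T[es+e]) Ss))

        e≢0 : e ≢ 0#
        e≢0 refl = ¬Te 0-twisted

        pick-fibre : ∀ {s w} → pick s ≡ w → s ∈ inv e * w ∷ inv e * w + 1# ∷ []
        pick-fibre {s} {w} pick-s≡w with twisted? (e * s)
        ... | yes _ = here (inv-cancel e≢0 pick-s≡w)
        ... | no  _ = there (here (x+y≡z⇒x≡z+y (inv-cancel e≢0
                        (trans (solve 2 (λ e s → e :* (s :+ con true) := e :* s :+ e) refl e s) pick-s≡w))))

        ∣scaled∣≤2∣twisted∣ : ∣ scaled? ∣ ≤ 2 Nat.* ∣ twisted? ∣
        ∣scaled∣≤2∣twisted∣ = ∣∣-≤-fibres scaled? twisted? pick 2 pick-twisted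
          λ w → ∣∣-≤-length (fibre? _≟_ pick scaled? w) (pick-fibre ∘ proj₂)

      ∣twisted∣≥quarter : 2 ^ n ≤ 4 Nat.* ∣ twisted? ∣
      ∣twisted∣≥quarter with ∃? (∁? twisted?)
      ... | no ∄¬T = begin
        2 ^ n                   ≡⟨ sym (∣∣-universal twisted? λ w → decidable-stable (twisted? w) λ ¬Tw → ∄¬T (w , ¬Tw)) ⟩
        ∣ twisted? ∣            ≤⟨ ℕₚ.m≤n*m _ 4 ⟩
        4 Nat.* ∣ twisted? ∣    ∎
        where open ℕₚ.≤-Reasoning
      ... | yes (e , ¬Te) = begin
        2 ^ n                            ≤⟨ indexTwo⇒half (scaled? ¬Te) (scaled-indexTwo ¬Te) ⟩
        2 Nat.* ∣ scaled? ¬Te ∣          ≤⟨ ℕₚ.*-monoʳ-≤ 2 (∣scaled∣≤2∣twisted∣ ¬Te) ⟩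
        2 Nat.* (2 Nat.* ∣ twisted? ∣)   ≡⟨ sym (ℕₚ.*-assoc 2 2 ∣ twisted? ∣) ⟩
        4 Nat.* ∣ twisted? ∣             ∎
        where open ℕₚ.≤-Reasoning

    shifts-sum : ∀ u v x → (u + x) + (v + x) + (u + v + x) ≡ x
    shifts-sum = solve 3 (λ u v x → (u :+ x) :+ (v :+ x) :+ (u :+ v :+ x) := x) refl

    -- (a + b + c)³ = a³ + b³ + c³ + (a + b)(b + c)(c + a) in characteristic 2.
    shifts-cube-sum : ∀ u v x → cube (u + x) + cube (v + x) + cube (u + v + x) ≡ cube x + u * v * (u + v)
    shifts-cube-sum = solve 3 (λ u v x →
        (u :+ x) :* (u :+ x) :* (u :+ x) :+ (v :+ x) :* (v :+ x) :* (v :+ x)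
          :+ (u :+ v :+ x) :* (u :+ v :+ x) :* (u :+ v :+ x)
        := x :* x :* x :+ u :* v :* (u :+ v)) refl

    shifts-distinct : ∀ {u v} x → u * v * (u + v) ≢ 0# →
                      u + x ≢ v + x × v + x ≢ u + v + x × u + x ≢ u + v + x
    shifts-distinct {u} {v} x uv[u+v]≢0 =
        (λ eq → uv[u+v]≢0 (trans (cong (u * v *_) (u+v≡0 eq)) (zeroʳ _)))
      , (λ eq → uv[u+v]≢0 (trans (cong (λ z → z * v * (z + v)) (u≡0 eq))
                                  (solve 1 (λ v → con false :* v :* (con false :+ v) := con false) refl v)))
      , (λ eq → uv[u+v]≢0 (trans (cong (λ z → u * z * (u + z)) (v≡0 eq))
                                  (solve 1 (λ u → u :* con false :* (u :+ con false) := con false) refl u)))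
      where
      vanish : ∀ c {a b} → c ≡ a + b → a ≡ b → c ≡ 0#
      vanish c c≡a+b refl = trans c≡a+b (x+x≡0 _)

      u+v≡0 : u + x ≡ v + x → u + v ≡ 0#
      u+v≡0 = vanish (u + v) (solve 3 (λ u v x → u :+ v := (u :+ x) :+ (v :+ x)) refl u v x)

      u≡0 : v + x ≡ u + v + x → u ≡ 0#
      u≡0 = vanish u (solve 3 (λ u v x → u := (v :+ x) :+ (u :+ v :+ x)) refl u v x)

      v≡0 : u + x ≡ u + v + x → v ≡ 0#
      v≡0 = vanish v (solve 3 (λ u v x → v := (u :+ x) :+ (u :+ v :+ x)) refl u v x)

    module Covers (x y : Carrier) (y≢x³ : y ≢ cube x) where

      open Inverse enum using (from; strictlyInverseˡ)

      D : Carrier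
      D = y + cube x

      D≢0 : D ≢ 0#
      D≢0 D≡0 = y≢x³ (trans (x+y≡z⇒x≡z+y D≡0) (+-identityˡ (cube x)))

      open CubeTwist D

      NonzeroTwisted : Pred Carrier 0ℓ
      NonzeroTwisted w = Twisted w × w ≢ 0#

      nonzeroTwisted? : Decidable NonzeroTwisted
      nonzeroTwisted? = twisted? ∩? ∁? (_≟ 0#)

      -- A twisted w ≠ 0 gives u = w⁻¹ and v = u s with ℘ s = D w³, so that u v (u + v) = D.
      u v : Carrier → Carrier
      u w = inv w
      v w = inv w * ℘-root (D * cube w)

      uv[u+v]≡D : ∀ {w} → NonzeroTwisted w → u w * v w * (u w + v w) ≡ D
      uv[u+v]≡D {w} (Tw , w≢0) = begin
        u w * (u w * s) * (u w + u w * s)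
          ≡⟨ solve 2 (λ u s → u :* (u :* s) :* (u :+ u :* s) := u :* u :* u :* (s :* s :+ s)) refl (u w) s ⟩
        u w * u w * u w * ℘ s                    ≡⟨ cong (u w * u w * u w *_) (℘-℘-root Tw) ⟩
        u w * u w * u w * (D * cube w)
          ≡⟨ solve 3 (λ u D w → u :* u :* u :* (D :* (w :* w :* w))
                             := D :* ((w :* u) :* (w :* u) :* (w :* u))) refl (u w) D w ⟩
        D * cube (w * u w)                       ≡⟨ cong (λ z → D * cube z) (x*inv-x≡1 w≢0) ⟩
        D * cube 1#                              ≡⟨ solve 1 (λ D → D :* (con true :* con true :* con true) := D) refl D ⟩
        D                                        ∎
        where
        open ≡-Reasoning
        s : Carrier
        s = ℘-root (D * cube w)

      triple : Carrier → Triple (2 ^ n)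
      triple w = sort₃ (from (u w + x)) (from (v w + x)) (from (u w + v w + x))

      triple-increasing : ∀ {w} → NonzeroTwisted w → Increasing (triple w)
      triple-increasing {w} Nw =
        let a≢b , b≢c , a≢c = shifts-distinct {u w} {v w} x uv[u+v]≢0
        in  sort₃-increasing (a≢b ∘ from-injective) (b≢c ∘ from-injective) (a≢c ∘ from-injective)
        where
        uv[u+v]≢0 : u w * v w * (u w + v w) ≢ 0#
        uv[u+v]≢0 uv[u+v]≡0 = D≢0 (trans (sym (uv[u+v]≡D Nw)) uv[u+v]≡0)

      triple-sums : ∀ {w} → NonzeroTwisted w → sumsTo F (x , y) (triple w)
      triple-sums {w} Nw = trans (on-points id) (shifts-sum (u w) (v w) x) , (begin
        fold₃ +-commutativeSemigroup (cube ∘ el) (triple w)      ≡⟨ on-points cube ⟩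
        cube (u w + x) + cube (v w + x) + cube (u w + v w + x)   ≡⟨ shifts-cube-sum (u w) (v w) x ⟩
        cube x + u w * v w * (u w + v w)                          ≡⟨ cong (cube x +_) (uv[u+v]≡D Nw) ⟩
        cube x + (y + cube x)                                     ≡⟨ solve 2 (λ c y → c :+ (y :+ c) := y) refl _ y ⟩
        y                                                         ∎)
        where
        open ≡-Reasoning
        on-points : ∀ (g : Carrier → Carrier) →
                    fold₃ +-commutativeSemigroup (g ∘ el) (triple w) ≡ g (u w + x) + g (v w + x) + g (u w + v w + x)
        on-points g = trans (sort₃-fold +-commutativeSemigroup (g ∘ el) _ _ _)
          (cong₂ _+_ (cong₂ _+_ (el∘from _) (el∘from _)) (el∘from _))
          where
          el∘from : ∀ a → g (el (from a)) ≡ g a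
          el∘from a = cong g (strictlyInverseˡ a)

      triple-fibre : ∀ {w t} → NonzeroTwisted w → triple w ≡ t → w ∈ map (λ i → inv (el i + x)) (entries t)
      triple-fibre {w} (_ , w≢0) refl =
        subst (_∈ map candidate (entries (triple w))) recover
              (∈-map⁺ candidate (∈-sort₃ (from (u w + x)) (from (v w + x)) (from (u w + v w + x))))
        where
        candidate : Fin (2 ^ n) → Carrier
        candidate i = inv (el i + x)

        recover : candidate (from (u w + x)) ≡ w
        recover = begin
          inv (el (from (u w + x)) + x)   ≡⟨ cong (λ z → inv (z + x)) (strictlyInverseˡ (u w + x)) ⟩
          inv (u w + x + x)               ≡⟨ cong inv (solve 2 (λ u x → u :+ x :+ x := u) refl (u w) x) ⟩
          inv (inv w)                     ≡⟨ inv-involutive w≢0 ⟩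
          w                               ∎
          where open ≡-Reasoning

      ∣nonzeroTwisted∣≤3*coverCount : ∣ nonzeroTwisted? ∣ ≤ 3 Nat.* coverCount F (x , y)
      ∣nonzeroTwisted∣≤3*coverCount =
        count-≤-fibres ≟-triple triple nonzeroTwisted? (sumsTo? F (x , y)) 3 elements (orderedTriples F)
        (λ Nw → increasing∈orderedTriples (triple-increasing Nw) , triple-sums Nw)
        (λ t → ∣∣-≤-length (fibre? ≟-triple triple nonzeroTwisted? t) λ (Nw , eq) → triple-fibre Nw eq)
        where
        ≟-triple : DecidableEquality (Triple (2 ^ n))
        ≟-triple = ≡-dec Fin._≟_ (≡-dec Fin._≟_ Fin._≟_)

      ∣twisted∣≤1+∣nonzeroTwisted∣ : ∣ twisted? ∣ ≤ 1 Nat.+ ∣ nonzeroTwisted? ∣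
      ∣twisted∣≤1+∣nonzeroTwisted∣ = begin
        ∣ twisted? ∣                                       ≡⟨ count-split twisted? (_≟ 0#) elements ⟩
        ∣ twisted? ∩? (_≟ 0#) ∣ Nat.+ ∣ nonzeroTwisted? ∣   ≤⟨ ℕₚ.+-monoˡ-≤ _ at-most-zero ⟩
        1 Nat.+ ∣ nonzeroTwisted? ∣                         ∎
        where
        open ℕₚ.≤-Reasoning
        at-most-zero : ∣ twisted? ∩? (_≟ 0#) ∣ ≤ 1
        at-most-zero = ℕₚ.≤-trans (count-mono _ (_≟ 0#) proj₂ elements) (ℕₚ.≤-reflexive (∣≟∣≡1 0#))

      coverCount-affine-bound : 2 ^ n ≤ 4 Nat.* (1 Nat.+ 3 Nat.* coverCount F (x , y))
      coverCount-affine-bound = begin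
        2 ^ n
          ≤⟨ ∣twisted∣≥quarter ⟩
        4 Nat.* ∣ twisted? ∣
          ≤⟨ ℕₚ.*-monoʳ-≤ 4 ∣twisted∣≤1+∣nonzeroTwisted∣ ⟩
        4 Nat.* (1 Nat.+ ∣ nonzeroTwisted? ∣)
          ≤⟨ ℕₚ.*-monoʳ-≤ 4 (ℕₚ.+-monoʳ-≤ 1 ∣nonzeroTwisted∣≤3*coverCount) ⟩
        4 Nat.* (1 Nat.+ 3 Nat.* coverCount F (x , y))
          ∎
        where open ℕₚ.≤-Reasoning

open Nat using (_*_; _<_)

affine⇒linear : ∀ {N} g → 8 ≤ N → N ≤ 4 * (1 Nat.+ 3 * g) → N ≤ 16 * g
affine⇒linear zero    8≤N N≤4 = contradiction (ℕₚ.≤-trans 8≤N N≤4) (ℕₚ.<⇒≱ (ℕₚ.m<m+n 4 (s≤s z≤n)))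
affine⇒linear (suc g) _   N≤  = begin
  _                        ≤⟨ N≤ ⟩
  4 * (1 Nat.+ 3 * suc g)  ≡⟨ solve 1 (λ g → con 4 :* (con 1 :+ con 3 :* (con 1 :+ g))
                                          := con 16 :+ con 12 :* g) refl g ⟩
  16 Nat.+ 12 * g          ≤⟨ ℕₚ.+-monoʳ-≤ 16 (ℕₚ.*-monoˡ-≤ g (ℕₚ.m≤m+n 12 4)) ⟩
  16 Nat.+ 16 * g          ≡⟨ ℕₚ.*-suc 16 g ⟨
  16 * suc g               ∎
  where
  open ℕₚ.≤-Reasoning
  open +-*-Solver

covers-linear : ∀ {n} → 2 < n → (F : FiniteField2^ n) (x y : FiniteField2^.Carrier F) →
                ¬ inS F (x , y) → 2 ^ n ≤ 16 * coverCount F (x , y)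
covers-linear 2<n F x y y≢x³ =
  affine⇒linear (coverCount F (x , y)) (ℕₚ.^-monoʳ-≤ 2 2<n) (coverCount-affine-bound x y y≢x³)
  where
  open FiniteFieldProperties F using (characteristic-two; module Characteristic2)
  open Characteristic2 (characteristic-two (ℕₚ.m+n≤o⇒n≤o 2 2<n)) using (module Covers)
  open Covers using (coverCount-affine-bound)

theorem2p3 : Σ ℕ λ p → Σ ℕ λ q → (0 < p) × (0 < q) × (Σ ℕ λ n₀ → (n : ℕ) → n₀ < n → (F : FiniteField2^ n) → (x y : FiniteField2^.Carrier F) → ¬ inS F (x , y) → p * 2 ^ n ≤ q * coverCount F (x , y))
theorem2p3 = 1 , 16 , s≤s z≤n , s≤s z≤n , 2 , λ n 2<n F x y y≢x³ →
  ℕₚ.≤-trans (ℕₚ.≤-reflexive (ℕₚ.*-identityˡ (2 ^ n))) (covers-linear 2<n F x y y≢x³)
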